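{- A formula $\varphi$ of $\mathsf L$ is satisfiable (resp. falsifiable) on an intuitionistic dynamic model if and only if it is satisfiable (resp. falsifiable) on an expanding model.
   Context: Formulas of $\mathsf L$: $p \mid \bot \mid \wedge \mid \vee \mid \to \mid \bigcirc \mid \Diamond \mid \Box \mid \mathsf U \mid \mathsf R$ over a countable set $\mathbb P$ of variables. An intuitionistic dynamic model is $(W,\preccurlyeq,S,V)$ with $W\ne\varnothing$, $\preccurlyeq$ a partial order, $S\colon W\to W$ with $w\preccurlyeq v\Rightarrow S(w)\preccurlyeq S(v)$, and $V\colon W\to\mathcal P(\mathbb P)$ with $w\preccurlyeq v\Rightarrow V(w)\subseteq V(v)$. Satisfaction: atoms by $V$; $\bot$ false; $\wedge,\vee$ classical; $w\models\bigcirc\varphi$ iff $S(w)\models\varphi$; $w\models\varphi\to\psi$ iff all $v\succcurlyeq w$ with $v\models\varphi$ have $v\models\psi$; $\Diamond\varphi$: some $S^k(w)\models\varphi$; $\Box\varphi$: all $S^k(w)\models\varphi$ ($k\ge 0$); $\varphi\,\mathsf U\,\psi$: some $k$ with $S^k(w)\models\psi$ and $S^i(w)\models\varphi$ for all $i<k$; $\varphi\,\mathsf R\,\psi$: for all $k$, $S^k(w)\models\psi$ or some $i<k$ has $S^i(w)\models\varphi$. A poset $(X,\le)$ is a tree if there is a relation $\uparrow$ on $X$ with $\le$ equal to the reflexive transitive closure of $\uparrow$, and an element $r$ (root) such that for every $x\in X$ there is a unique $\uparrow$-path from $r$ to $x$. A model is stratified if there is a partition $\{W_n\}_{n<\omega}$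 of $W$ such that each $W_n$ is closed under $\preccurlyeq$, each $(W_n,\preccurlyeq\restriction W_n)$ is a tree, and $w\in W_n$ implies $S(w)\in W_{n+1}$. A stratified model is expanding if moreover $S(w)\preccurlyeq S(v)$ implies $w\preccurlyeq v$. -}

module Defs where

open import Data.Nat using (ℕ; zero; suc; _<_)
open import Data.Product using (Σ; _×_; _,_)
open import Data.Sum using (_⊎_)
open import Data.Empty using (⊥)
open import Data.List using (List; []; _∷_)
open import Relation.Nullary using (¬_)
open import Relation.Binary.PropositionalEquality using (_≡_)
open import Relation.Binary.Structures using (IsPartialOrder)
open import Relation.Binary.Construct.Closure.ReflexiveTransitive using (Star)
open import Function.Bundles using (_⇔_)

Var : Set
Var = ℕ

data Form : Set where
  var  : Var → Form
  ⊥'   : Form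
  _∧'_ : Form → Form → Form
  _∨'_ : Form → Form → Form
  _⇒_  : Form → Form → Form
  ◯_   : Form → Form
  ◇_   : Form → Form
  □_   : Form → Form
  _U_  : Form → Form → Form
  _R_  : Form → Form → Form

iter : {A : Set} → (A → A) → ℕ → A → A
iter f zero    a = a
iter f (suc k) a = f (iter f k a)

record DynModel : Set₁ where
  field
    W      : Set
    inhab  : W
    _≼_    : W → W → Set
    ≼-po   : IsPartialOrder _≡_ _≼_
    S      : W → W
    S-mono : ∀ {w v} → w ≼ v → S w ≼ S v
    V      : W → Var → Set
    V-mono : ∀ {w v} (p : Var) → w ≼ v → V w p → V v p

module _ (M : DynModel) where
  open DynModel M

  Sat : W → Form → Set
  Sat w (var p)   = V w p
  Sat w ⊥'        = ⊥
  Sat w (φ ∧' ψ)  = Sat w φ × Sat w ψ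
  Sat w (φ ∨' ψ)  = Sat w φ ⊎ Sat w ψ
  Sat w (φ ⇒ ψ)   = ∀ v → w ≼ v → Sat v φ → Sat v ψ
  Sat w (◯ φ)     = Sat (S w) φ
  Sat w (◇ φ)     = Σ ℕ λ k → Sat (iter S k w) φ
  Sat w (□ φ)     = ∀ k → Sat (iter S k w) φ
  Sat w (φ U ψ)   = Σ ℕ λ k → Sat (iter S k w) ψ × (∀ i → i < k → Sat (iter S i w) φ)
  Sat w (φ R ψ)   = ∀ k → Sat (iter S k w) ψ ⊎ (Σ ℕ λ i → i < k × Sat (iter S i w) φ)

-- ↑-paths from r to x, recorded as the list of vertices visited after r.
PathTo : {X : Set} → (X → X → Set) → X → List X → X → Set
PathTo _↑_ r []       x = r ≡ x
PathTo _↑_ r (y ∷ ys) x = (r ↑ y) × PathTo _↑_ y ys x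

IsTree : (X : Set) → (X → X → Set) → Set₁
IsTree X _≤_ =
  Σ (X → X → Set) λ _↑_ →
    (∀ x y → (x ≤ y) ⇔ Star _↑_ x y) ×
    Σ X λ r → ∀ x → Σ (List X) λ xs → PathTo _↑_ r xs x ×
                      (∀ ys → PathTo _↑_ r ys x → ys ≡ xs)

-- Stratified model: partition {W_n} given by a layer map W → ℕ.
record Stratified (M : DynModel) : Set₁ where
  open DynModel M
  field
    layer       : W → ℕ
    layer-closed : ∀ {w v} → w ≼ v → layer w ≡ layer v
    layer-tree  : ∀ n → IsTree (Σ W λ w → layer w ≡ n)
                               (λ a b → Σ.proj₁ a ≼ Σ.proj₁ b)
    layer-S     : ∀ w → layer (S w) ≡ suc (layer w)

Expanding : DynModel → Set₁
Expanding M = Stratified M × (∀ w v → S w ≼ S v → w ≼ v)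
  where open DynModel M

Satisfiable : (M : DynModel) → Form → Set
Satisfiable M φ = Σ (DynModel.W M) λ w → Sat M w φ

Falsifiable : (M : DynModel) → Form → Set
Falsifiable M φ = Σ (DynModel.W M) λ w → ¬ Sat M w φ

-- Unravel a pointed model (M, w₀) into the model of its finite histories: a history
-- starts at w₀ and repeatedly either moves up along ≼ or applies S, and it is labelled
-- by the world it ends in.  Histories are ordered by extension with one ≼-step and by
-- the S-images of such extensions, and layered by their number of S-steps.  Each layer
-- is then a tree rooted at the history that only applies S, and S reflects the order.
-- The labelling is a bounded morphism onto M, so it preserves and reflects every
-- formula, and the trivial history satisfies exactly the formulas w₀ does.
module Submission where

open import Defs
open import Data.Empty using (⊥; ⊥-elim)
open import Data.List using (List; []; _∷_; length)
open import Data.Nat using (ℕ; zero; suc; _+_; _≤_)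
open import Data.Nat.Properties
  using (≡-irrelevant; ≤-refl; ≤-trans; ≤-reflexive; n≤1+n; <-irrefl; +-suc; +-cancelʳ-≡)
open import Data.Product using (Σ; _×_; _,_; proj₁; proj₂)
open import Data.Sum using (inj₁; inj₂)
open import Data.Unit using (⊤; tt)
open import Function.Base using (id; _∘_; _on_)
open import Function.Bundles using (_⇔_; mk⇔; Equivalence)
open import Relation.Binary.PropositionalEquality
  using (_≡_; refl; sym; trans; cong; cong₂; subst; module ≡-Reasoning)
open import Relation.Binary.Structures using (IsPartialOrder)
open import Relation.Binary.Construct.Closure.ReflexiveTransitive
  using (Star; ε; _◅_; _◅◅_; gmap)
import Relation.Binary.Construct.Closure.ReflexiveTransitive.Properties as Star

Star⇒PathTo : ∀ {X : Set} {_↑_ : X → X → Set} {a b} →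
              Star _↑_ a b → Σ (List X) λ xs → PathTo _↑_ a xs b
Star⇒PathTo ε                 = [] , refl
Star⇒PathTo (_◅_ {j = y} e s) = let xs , p = Star⇒PathTo s in y ∷ xs , e , p

module _ {X : Set} {_↑_ : X → X → Set} (parent : X → X) (depth : X → ℕ)
         (↑-parent : ∀ {x y} → x ↑ y → parent y ≡ x)
         (↑-depth  : ∀ {x y} → x ↑ y → depth y ≡ suc (depth x)) where

  ancestors : ℕ → X → List X
  ancestors zero    x = []
  ancestors (suc k) x = iter parent k x ∷ ancestors k x

  PathTo-ancestors : ∀ {a x} ys → PathTo _↑_ a ys x →
                     ys ≡ ancestors (length ys) x × a ≡ iter parent (length ys) x
  PathTo-ancestors []       a≡x       = refl , a≡x
  PathTo-ancestors (y ∷ ys) (a↑y , p) =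
    let ys≡ , y≡ = PathTo-ancestors ys p
    in cong₂ _∷_ y≡ ys≡ , trans (sym (↑-parent a↑y)) (cong parent y≡)

  PathTo-depth : ∀ {a x} ys → PathTo _↑_ a ys x → depth x ≡ length ys + depth a
  PathTo-depth []       refl              = refl
  PathTo-depth {a} {x} (y ∷ ys) (a↑y , p) = begin
    depth x                     ≡⟨ PathTo-depth ys p ⟩
    length ys + depth y         ≡⟨ cong (length ys +_) (↑-depth a↑y) ⟩
    length ys + suc (depth a)   ≡⟨ +-suc (length ys) (depth a) ⟩
    suc (length ys + depth a)   ∎
    where open ≡-Reasoning

  -- A path is the list of ancestors of its endpoint, and depth fixes its length.
  PathTo-unique : ∀ {a x} xs ys → PathTo _↑_ a xs x → PathTo _↑_ a ys x → xs ≡ ys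
  PathTo-unique {x = x} xs ys p q = begin
    xs                        ≡⟨ proj₁ (PathTo-ancestors xs p) ⟩
    ancestors (length xs) x   ≡⟨ cong (λ k → ancestors k x) same-length ⟩
    ancestors (length ys) x   ≡⟨ sym (proj₁ (PathTo-ancestors ys q)) ⟩
    ys                        ∎
    where
    open ≡-Reasoning
    same-length : length xs ≡ length ys
    same-length = +-cancelʳ-≡ _ (length xs) (length ys)
                    (trans (sym (PathTo-depth xs p)) (PathTo-depth ys q))

  rooted⇒IsTree : ∀ {_≤_ : X → X → Set} → (∀ x y → (x ≤ y) ⇔ Star _↑_ x y) →
                  (r : X) → (∀ x → Star _↑_ r x) → IsTree X _≤_
  rooted⇒IsTree ≤⇔↑* r reach = _↑_ , ≤⇔↑* , r , λ x →
    let xs , p = Star⇒PathTo (reach x) in xs , p , λ ys q → PathTo-unique ys xs q p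

fiber-≡ : ∀ {A : Set} {f : A → ℕ} {n} {a b : Σ A λ x → f x ≡ n} → proj₁ a ≡ proj₁ b → a ≡ b
fiber-≡ {a = x , p} {b = .x , q} refl = cong (x ,_) (≡-irrelevant p q)

Star-fiber : ∀ {A : Set} {_∼_ : A → A → Set} {f : A → ℕ} → (∀ {x y} → x ∼ y → f x ≡ f y) →
             ∀ {n x y} → Star _∼_ x y → (p : f x ≡ n) (q : f y ≡ n) →
             Star (_∼_ on proj₁) (x , p) (y , q)
Star-fiber ∼-f ε       p q = subst (Star _ (_ , p)) (fiber-≡ refl) ε
Star-fiber ∼-f (e ◅ s) p q = e ◅ Star-fiber ∼-f s (trans (sym (∼-f e)) p) q

module _ (N M : DynModel) where
  private
    module N = DynModel N
    module M = DynModel M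

  record BoundedMorphism : Set where
    field
      map      : N.W → M.W
      map-mono : ∀ {x y} → x N.≼ y → map x M.≼ map y
      map-S    : ∀ x → map (N.S x) ≡ M.S (map x)
      map-V    : ∀ x p → N.V x p ⇔ M.V (map x) p
      back     : ∀ {x v} → map x M.≼ v → Σ N.W λ y → x N.≼ y × map y ≡ v

module _ {N M : DynModel} (h : BoundedMorphism N M) where
  private
    module N = DynModel N
    module M = DynModel M
  open BoundedMorphism h

  map-iter : ∀ k x → map (iter N.S k x) ≡ iter M.S k (map x)
  map-iter zero    x = refl
  map-iter (suc k) x = trans (map-S (iter N.S k x)) (cong M.S (map-iter k x))

  preserves-Sat      : ∀ φ x → Sat N x φ → Sat M (map x) φ
  reflects-Sat       : ∀ φ x → Sat M (map x) φ → Sat N x φ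
  preserves-Sat-iter : ∀ φ k x → Sat N (iter N.S k x) φ → Sat M (iter M.S k (map x)) φ
  reflects-Sat-iter  : ∀ φ k x → Sat M (iter M.S k (map x)) φ → Sat N (iter N.S k x) φ

  preserves-Sat-iter φ k x s = subst (λ w → Sat M w φ) (map-iter k x) (preserves-Sat φ _ s)
  reflects-Sat-iter φ k x s = reflects-Sat φ _ (subst (λ w → Sat M w φ) (sym (map-iter k x)) s)

  preserves-Sat (var p)  x s               = Equivalence.to (map-V x p) s
  preserves-Sat (φ ∧' ψ) x (s , t)         = preserves-Sat φ x s , preserves-Sat ψ x t
  preserves-Sat (φ ∨' ψ) x (inj₁ s)        = inj₁ (preserves-Sat φ x s)
  preserves-Sat (φ ∨' ψ) x (inj₂ t)        = inj₂ (preserves-Sat ψ x t)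
  preserves-Sat (φ ⇒ ψ)  x f v x≼v s with back x≼v
  ... | y , x≼y , refl                     = preserves-Sat ψ y (f y x≼y (reflects-Sat φ y s))
  preserves-Sat (◯ φ)    x s               = preserves-Sat-iter φ 1 x s
  preserves-Sat (◇ φ)    x (k , s)         = k , preserves-Sat-iter φ k x s
  preserves-Sat (□ φ)    x f k             = preserves-Sat-iter φ k x (f k)
  preserves-Sat (φ U ψ)  x (k , t , f)     =
    k , preserves-Sat-iter ψ k x t , λ i i<k → preserves-Sat-iter φ i x (f i i<k)
  preserves-Sat (φ R ψ)  x f k with f k
  ... | inj₁ t                             = inj₁ (preserves-Sat-iter ψ k x t)
  ... | inj₂ (i , i<k , s)                 = inj₂ (i , i<k , preserves-Sat-iter φ i x s)

  reflects-Sat (var p)  x s                = Equivalence.from (map-V x p) s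
  reflects-Sat (φ ∧' ψ) x (s , t)          = reflects-Sat φ x s , reflects-Sat ψ x t
  reflects-Sat (φ ∨' ψ) x (inj₁ s)         = inj₁ (reflects-Sat φ x s)
  reflects-Sat (φ ∨' ψ) x (inj₂ t)         = inj₂ (reflects-Sat ψ x t)
  reflects-Sat (φ ⇒ ψ)  x f y x≼y s        =
    reflects-Sat ψ y (f (map y) (map-mono x≼y) (preserves-Sat φ y s))
  reflects-Sat (◯ φ)    x s                = reflects-Sat-iter φ 1 x s
  reflects-Sat (◇ φ)    x (k , s)          = k , reflects-Sat-iter φ k x s
  reflects-Sat (□ φ)    x f k              = reflects-Sat-iter φ k x (f k)
  reflects-Sat (φ U ψ)  x (k , t , f)      =
    k , reflects-Sat-iter ψ k x t , λ i i<k → reflects-Sat-iter φ i x (f i i<k)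
  reflects-Sat (φ R ψ)  x f k with f k
  ... | inj₁ t                             = inj₁ (reflects-Sat-iter ψ k x t)
  ... | inj₂ (i , i<k , s)                 = inj₂ (i , i<k , reflects-Sat-iter φ i x s)

  Sat-invariant : ∀ φ x → Sat N x φ ⇔ Sat M (map x) φ
  Sat-invariant φ x = mk⇔ (preserves-Sat φ x) (reflects-Sat φ x)

module Unravelling (M : DynModel) (w₀ : DynModel.W M) where
  open DynModel M

  data Node : ℕ → Set
  world : ∀ {n} → Node n → W

  -- Histories of layer n: ext takes a ≼-step, next applies S.
  data Node where
    root : Node zero
    ext  : ∀ {n} (c : Node n) (u : W) → world c ≼ u → Node n
    next : ∀ {n} → Node n → Node (suc n)

  world root        = w₀
  world (ext c u _) = u
  world (next c)    = S (world c)

  parentNode : ∀ {n} → Node n → Node n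
  parentNode root        = root
  parentNode (ext c _ _) = c
  parentNode (next c)    = next (parentNode c)

  depthNode : ∀ {n} → Node n → ℕ
  depthNode root        = zero
  depthNode (ext c _ _) = suc (depthNode c)
  depthNode (next c)    = depthNode c

  base : ∀ n → Node n
  base zero    = root
  base (suc n) = next (base n)

  Point : Set
  Point = Σ ℕ Node

  origin : Point
  origin = zero , root

  label : Point → W
  label (_ , c) = world c

  succ : Point → Point
  succ (n , c) = suc n , next c

  parent : Point → Point
  parent (n , c) = n , parentNode c

  depth : Point → ℕ
  depth (_ , c) = depthNode c

  data _↑_ : Point → Point → Set where
    ext↑  : ∀ {n c u p} → (n , c) ↑ (n , ext c u p)
    next↑ : ∀ {n c d} → (n , c) ↑ (n , d) → (suc n , next c) ↑ (suc n , next d)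

  _≼⁺_ : Point → Point → Set
  _≼⁺_ = Star _↑_

  ↑-succ : ∀ {x y} → x ↑ y → succ x ↑ succ y
  ↑-succ e@ext↑      = next↑ e
  ↑-succ e@(next↑ _) = next↑ e

  ↑-layer : ∀ {x y} → x ↑ y → proj₁ x ≡ proj₁ y
  ↑-layer ext↑      = refl
  ↑-layer (next↑ _) = refl

  ↑-parent : ∀ {x y} → x ↑ y → parent y ≡ x
  ↑-parent ext↑      = refl
  ↑-parent (next↑ e) = cong succ (↑-parent e)

  ↑-depth : ∀ {x y} → x ↑ y → depth y ≡ suc (depth x)
  ↑-depth ext↑      = refl
  ↑-depth (next↑ e) = ↑-depth e

  ↑-label : ∀ {x y} → x ↑ y → label x ≼ label y
  ↑-label (ext↑ {p = p}) = p
  ↑-label (next↑ e)      = S-mono (↑-label e)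

  ≼⁺-layer : ∀ {x y} → x ≼⁺ y → proj₁ x ≡ proj₁ y
  ≼⁺-layer ε       = refl
  ≼⁺-layer (e ◅ s) = trans (↑-layer e) (≼⁺-layer s)

  ≼⁺-depth : ∀ {x y} → x ≼⁺ y → depth x ≤ depth y
  ≼⁺-depth ε       = ≤-refl
  ≼⁺-depth (e ◅ s) = ≤-trans (n≤1+n _) (≤-trans (≤-reflexive (sym (↑-depth e))) (≼⁺-depth s))

  ≼⁺-antisym : ∀ {x y} → x ≼⁺ y → y ≼⁺ x → x ≡ y
  ≼⁺-antisym ε       _ = refl
  ≼⁺-antisym (e ◅ s) t = ⊥-elim (<-irrefl refl
    (≤-trans (≤-reflexive (sym (↑-depth e))) (≤-trans (≼⁺-depth s) (≼⁺-depth t))))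

  label-mono : ∀ {x y} → x ≼⁺ y → label x ≼ label y
  label-mono ε       = IsPartialOrder.refl ≼-po
  label-mono (e ◅ s) = IsPartialOrder.trans ≼-po (↑-label e) (label-mono s)

  unravelled : DynModel
  unravelled = record
    { W      = Point
    ; inhab  = origin
    ; _≼_    = _≼⁺_
    ; ≼-po   = record { isPreorder = Star.isPreorder _↑_ ; antisym = ≼⁺-antisym }
    ; S      = succ
    ; S-mono = gmap succ ↑-succ
    ; V      = λ x → V (label x)
    ; V-mono = λ p x≼y → V-mono p (label-mono x≼y)
    }

  label-boundedMorphism : BoundedMorphism unravelled M
  label-boundedMorphism = record
    { map      = label
    ; map-mono = label-mono
    ; map-S    = λ _ → refl
    ; map-V    = λ _ _ → mk⇔ id id
    ; back     = λ {x} {v} x≼v → (proj₁ x , ext (proj₂ x) v x≼v) , ext↑ ◅ ε , refl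
    }

  reach : ∀ {n} (c : Node n) → (n , base n) ≼⁺ (n , c)
  reach root        = ε
  reach (ext c _ _) = reach c ◅◅ (ext↑ ◅ ε)
  reach (next c)    = gmap succ ↑-succ (reach c)

  module Layer (n : ℕ) where
    Fiber : Set
    Fiber = Σ Point λ x → proj₁ x ≡ n

    parentFiber : Fiber → Fiber
    parentFiber (x , p) = parent x , p

    layer-IsTree : IsTree Fiber (_≼⁺_ on proj₁)
    layer-IsTree =
      rooted⇒IsTree parentFiber (depth ∘ proj₁) (λ e → fiber-≡ (↑-parent e)) ↑-depth
        (λ a b → mk⇔ (λ s → Star-fiber ↑-layer s (proj₂ a) (proj₂ b)) (gmap proj₁ id))
        ((n , base n) , refl)
        λ { ((.n , c) , refl) → Star-fiber ↑-layer (reach c) refl refl }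

  IsExt : Point → Set
  IsExt (_ , ext _ _ _) = ⊤
  IsExt _               = ⊥

  ext-closed : ∀ {x y} → x ≼⁺ y → IsExt x → IsExt y
  ext-closed ε             x-ext = x-ext
  ext-closed (ext↑ ◅ s)    _     = ext-closed s tt
  ext-closed (next↑ _ ◅ _) ()

  -- No next-node lies above an ext-node, so a path between next-nodes uses only next↑.
  ≼⁺-unsucc : ∀ {n m c d} → (suc n , next c) ≼⁺ (suc m , next d) → (n , c) ≼⁺ (m , d)
  ≼⁺-unsucc ε             = ε
  ≼⁺-unsucc (ext↑ ◅ s)    = ⊥-elim (ext-closed s tt)
  ≼⁺-unsucc (next↑ e ◅ s) = e ◅ ≼⁺-unsucc s

  unravelled-expanding : Expanding unravelled
  unravelled-expanding = stratified , λ _ _ → ≼⁺-unsucc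
    where
    stratified : Stratified unravelled
    stratified = record
      { layer        = proj₁
      ; layer-closed = ≼⁺-layer
      ; layer-tree   = Layer.layer-IsTree
      ; layer-S      = λ _ → refl
      }

expanding-equivalent : (M : DynModel) (w : DynModel.W M) →
  Σ DynModel λ N → Expanding N × Σ (DynModel.W N) λ x → ∀ φ → Sat N x φ ⇔ Sat M w φ
expanding-equivalent M w =
  unravelled , unravelled-expanding , origin , λ φ → Sat-invariant label-boundedMorphism φ origin
  where open Unravelling M w

theorem3p8 : (φ : Form) →
    ((Σ DynModel λ M → Satisfiable M φ) ⇔ (Σ DynModel λ M → Expanding M × Satisfiable M φ)) ×
    ((Σ DynModel λ M → Falsifiable M φ) ⇔ (Σ DynModel λ M → Expanding M × Falsifiable M φ))
theorem3p8 φ = mk⇔ satisfiable⇒ forget , mk⇔ falsifiable⇒ forget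
  where
  forget : ∀ {P : DynModel → Set} → Σ DynModel (λ M → Expanding M × P M) → Σ DynModel P
  forget (M , _ , s) = M , s

  satisfiable⇒ : Σ DynModel (λ M → Satisfiable M φ) → Σ DynModel (λ M → Expanding M × Satisfiable M φ)
  satisfiable⇒ (M , w , s) =
    let N , N-expanding , x , x≡w = expanding-equivalent M w
    in N , N-expanding , x , Equivalence.from (x≡w φ) s

  falsifiable⇒ : Σ DynModel (λ M → Falsifiable M φ) → Σ DynModel (λ M → Expanding M × Falsifiable M φ)
  falsifiable⇒ (M , w , s) =
    let N , N-expanding , x , x≡w = expanding-equivalent M w
    in N , N-expanding , x , λ t → s (Equivalence.to (x≡w φ) t)
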